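{- Let $G$ be a non-diregular $k$-geodetic digraph that is out-regular of degree $d$ and has order $M(d,k)+\epsilon$. If there is a vertex $v'$ with $d^-(v')=d+\epsilon$, then $O(u)\subseteq N^-(v')$ for every vertex $u$ of $G$.
   Context: $M(d,k)=1+d+\dots+d^k$. A digraph is $k$-geodetic if for any two vertices $u,v$ there is at most one directed walk from $u$ to $v$ of length at most $k$. For a vertex $u$, the outlier set $O(u)$ is the set of vertices $v$ such that there is no directed path of length at most $k$ (length $0$ allowed) from $u$ to $v$. $N^-(v')$ is the in-neighbourhood of $v'$. -}

module Defs where

open import Data.Nat using (ℕ; zero; suc; _+_; _*_; _^_; _≤_)
open import Data.Fin using (Fin)
open import Data.Bool using (Bool; true)
open import Data.List using (List; length; filter; allFin)
open import Data.Product using (Σ; _×_; _,_; ∃)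
open import Relation.Binary.PropositionalEquality using (_≡_)
open import Relation.Nullary using (¬_)
open import Data.Bool.Properties using (T?)
open import Data.Bool using (T)

Digraph : ℕ → Set
Digraph n = Fin n → Fin n → Bool

M : ℕ → ℕ → ℕ
M d zero    = 1
M d (suc k) = M d k + d ^ suc k

module _ {n : ℕ} (G : Digraph n) where

  Arc : Fin n → Fin n → Set
  Arc u v = G u v ≡ true

  data Walk : Fin n → Fin n → ℕ → Set where
    [] : ∀ {u} → Walk u u zero
    _∷_ : ∀ {u w v l} → Arc u w → Walk w v l → Walk u v (suc l)

  KGeodetic : ℕ → Set
  KGeodetic k = ∀ u v {l₁ l₂} → l₁ ≤ k → l₂ ≤ k →
    (p : Walk u v l₁) (q : Walk u v l₂) →
    _≡_ {A = Σ ℕ (Walk u v)} (l₁ , p) (l₂ , q)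

  outNbrs : Fin n → List (Fin n)
  outNbrs u = filter (λ v → T? (G u v)) (allFin n)

  inNbrs : Fin n → List (Fin n)
  inNbrs v = filter (λ u → T? (G u v)) (allFin n)

  outdeg indeg : Fin n → ℕ
  outdeg u = length (outNbrs u)
  indeg v = length (inNbrs v)

  OutRegular : ℕ → Set
  OutRegular d = ∀ u → outdeg u ≡ d

  Diregular : Set
  Diregular = ∃ λ d → (∀ u → outdeg u ≡ d) × (∀ u → indeg u ≡ d)

  -- v ∈ O(u): no directed walk (equivalently, path) of length ≤ k from u to v
  Outlier : ℕ → Fin n → Fin n → Set
  Outlier k u v = ∀ l → l ≤ k → ¬ Walk u v l

  InNbr : Fin n → Fin n → Set
  InNbr v u = Arc u v

module Submission where

-- Let G be k-geodetic and d-out-regular on M(d,k) + ε vertices, let v′ have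
-- in-degree d + ε, let u be a vertex and w ∈ O(u).  Write T(u) for the
-- out-tree of u: the list of endpoints of all walks of length ≤ k from u.
--
--  * T(u) has exactly M(d,k) entries (out-regularity) and no repetitions
--    (geodeticity), so at most ε vertices lie outside T(u).
--  * At most outdeg u = d in-neighbours x of v′ lie in T(u): the first arc
--    u → y of the walk u ⇝ x → v′ determines x, because the remaining walk
--    y ⇝ v′ has length ≤ k and is therefore unique.
--  * Hence at least ε in-neighbours of v′ lie outside T(u).  If w were not
--    an in-neighbour of v′, then w together with them would give ε + 1
--    distinct vertices outside T(u), a contradiction.

open import Defs
open import Level using (0ℓ)
open import Data.Nat using (ℕ; zero; suc; _+_; _*_; _^_; _≤_; _<_; z≤n; s≤s)
open import Data.Nat.Properties
open import Data.Fin using (Fin) renaming (_≟_ to _≟ᶠ_)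
open import Data.Bool using (true; false)
open import Data.Bool.Properties using (T?; T-≡)
open import Data.List using (List; []; _∷_; _++_; length; filter; allFin)
open import Data.List.Properties using (length-++; length-++-sucʳ; length-tabulate)
open import Data.List.Membership.Propositional using (_∈_; _∉_)
open import Data.List.Membership.Propositional.Properties
  using (∈-∃++; ∈-++⁻; ∈-++⁺ˡ; ∈-++⁺ʳ; ∈-filter⁺; ∈-filter⁻; ∈-allFin)
import Data.List.Membership.DecPropositional as DecMembership
open import Data.List.Relation.Unary.Any using (here; there)
import Data.List.Relation.Unary.All as All
open import Data.List.Relation.Unary.AllPairs using ([]; _∷_)
open import Data.List.Relation.Unary.Unique.Propositional using (Unique)
import Data.List.Relation.Unary.Unique.Propositional.Properties as Unique
open import Data.Product using (Σ; ∃; _×_; _,_; proj₁; proj₂)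
open import Data.Sum using (inj₁; inj₂)
open import Data.Empty using (⊥-elim)
open import Function.Bundles using (Equivalence)
open import Relation.Nullary using (¬_; yes; no)
open import Relation.Unary using (Pred; Decidable)
open import Relation.Unary.Properties using (∁?)
open import Relation.Binary.PropositionalEquality

length-≤-by-injection : ∀ {A B : Set} (R : A → B → Set) (xs : List A) (ys : List B) →
  Unique xs →
  (∀ {x x′ y} → x ∈ xs → x′ ∈ xs → R x y → R x′ y → x ≡ x′) →
  (∀ {x} → x ∈ xs → ∃ λ y → y ∈ ys × R x y) →
  length xs ≤ length ys
length-≤-by-injection R [] ys _ _ _ = z≤n
length-≤-by-injection R (x ∷ xs) ys (x∉xs ∷ xs-unique) injective image
  with y , y∈ys , Rxy ← image (here refl)
  with ys₁ , ys₂ , refl ← ∈-∃++ y∈ys =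
  subst (suc (length xs) ≤_) (sym (length-++-sucʳ ys₁ y ys₂))
    (s≤s (length-≤-by-injection R xs (ys₁ ++ ys₂) xs-unique
      (λ m m′ → injective (there m) (there m′)) image′))
  where
    -- the elements of xs are not related to y, so they land in ys without y
    image′ : ∀ {x′} → x′ ∈ xs → ∃ λ y′ → y′ ∈ ys₁ ++ ys₂ × R x′ y′
    image′ m with y′ , y′∈ , Rx′y′ ← image (there m) with ∈-++⁻ ys₁ y′∈
    ... | inj₁ p = y′ , ∈-++⁺ˡ p , Rx′y′
    ... | inj₂ (here refl) = ⊥-elim (All.lookup x∉xs m (injective (here refl) (there m) Rxy Rx′y′))
    ... | inj₂ (there p) = y′ , ∈-++⁺ʳ ys₁ p , Rx′y′

unique-length-≤ : ∀ {n} (xs : List (Fin n)) → Unique xs → length xs ≤ n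
unique-length-≤ {n} xs xs-unique =
  subst (length xs ≤_) (length-tabulate {n = n} (λ i → i))
    (length-≤-by-injection _≡_ xs (allFin n) xs-unique
      (λ _ _ x≡y x′≡y → trans x≡y (sym x′≡y)) (λ {x} _ → x , ∈-allFin x , refl))

length-filter-split : ∀ {A : Set} {P : Pred A 0ℓ} (P? : Decidable P) (xs : List A) →
  length (filter P? xs) + length (filter (∁? P?) xs) ≡ length xs
length-filter-split P? [] = refl
length-filter-split P? (x ∷ xs) with P? x
... | yes _ = cong suc (length-filter-split P? xs)
... | no _ = trans (+-suc _ _) (cong suc (length-filter-split P? xs))

M-suc : ∀ d j → suc (d * M d j) ≡ M d (suc j)
M-suc d zero = refl
M-suc d (suc j) = begin
  suc (d * (M d j + d ^ suc j))    ≡⟨ cong suc (*-distribˡ-+ d (M d j) (d ^ suc j)) ⟩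
  suc (d * M d j) + d * d ^ suc j  ≡⟨ cong (_+ d * d ^ suc j) (M-suc d j) ⟩
  M d (suc j) + d * d ^ suc j      ∎
  where open ≡-Reasoning

module _ {n : ℕ} (G : Digraph n) where

  ∈outNbrs⇒Arc : ∀ {u x} → x ∈ outNbrs G u → Arc G u x
  ∈outNbrs⇒Arc {u} m = Equivalence.to T-≡ (proj₂ (∈-filter⁻ (λ v → T? (G u v)) {xs = allFin n} m))

  Arc⇒∈outNbrs : ∀ {u x} → Arc G u x → x ∈ outNbrs G u
  Arc⇒∈outNbrs {u} {x} a = ∈-filter⁺ (λ v → T? (G u v)) (∈-allFin x) (Equivalence.from T-≡ a)

  ∈inNbrs⇒Arc : ∀ {v x} → x ∈ inNbrs G v → Arc G x v
  ∈inNbrs⇒Arc {v} m = Equivalence.to T-≡ (proj₂ (∈-filter⁻ (λ u → T? (G u v)) {xs = allFin n} m))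

  outNbrs-unique : ∀ u → Unique (outNbrs G u)
  outNbrs-unique u = Unique.filter⁺ _ (Unique.allFin⁺ n)

  inNbrs-unique : ∀ v → Unique (inNbrs G v)
  inNbrs-unique v = Unique.filter⁺ _ (Unique.allFin⁺ n)

  snoc : ∀ {a b c l} → Walk G a b l → Arc G b c → Walk G a c (suc l)
  snoc [] e = e ∷ []
  snoc (e′ ∷ p) e = e′ ∷ snoc p e

  -- penultimate s r: the penultimate vertex of the walk that steps from s to
  -- the start of r and then follows r.
  penultimate : ∀ {a b l} → Fin n → Walk G a b l → Fin n
  penultimate s [] = s
  penultimate s (_∷_ {u = a} _ r) = penultimate a r

  penultimate-snoc : ∀ {a b c l} s (p : Walk G a b l) (e : Arc G b c) →
    penultimate s (snoc p e) ≡ b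
  penultimate-snoc s [] e = refl
  penultimate-snoc s (e′ ∷ p) e = penultimate-snoc _ p e

  -- The out-tree of u of depth j: u followed by the out-trees of depth j - 1
  -- of the out-neighbours of u; it lists the endpoints of all walks of
  -- length ≤ j from u, one entry per walk.
  tree : Fin n → ℕ → List (Fin n)
  forest : List (Fin n) → ℕ → List (Fin n)
  tree u zero = u ∷ []
  tree u (suc j) = u ∷ forest (outNbrs G u) j
  forest [] j = []
  forest (x ∷ xs) j = tree x j ++ forest xs j

  tree-walk : ∀ {z} u j → z ∈ tree u j → ∃ λ l → l ≤ j × Walk G u z l
  forest-walk : ∀ {z} xs j → z ∈ forest xs j → ∃ λ x → x ∈ xs × (∃ λ l → l ≤ j × Walk G x z l)
  tree-walk u zero (here refl) = 0 , z≤n , []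
  tree-walk u (suc j) (here refl) = 0 , z≤n , []
  tree-walk u (suc j) (there m)
    with x , x∈ , l , l≤j , p ← forest-walk (outNbrs G u) j m =
    suc l , s≤s l≤j , ∈outNbrs⇒Arc x∈ ∷ p
  forest-walk (x ∷ xs) j m with ∈-++⁻ (tree x j) m
  ... | inj₁ m₁ = x , here refl , tree-walk x j m₁
  ... | inj₂ m₂ with x′ , x′∈ , walk ← forest-walk xs j m₂ = x′ , there x′∈ , walk

  outlier-∉-tree : ∀ {k u w} → Outlier G k u w → w ∉ tree u k
  outlier-∉-tree {k} {u} outlier m with l , l≤k , p ← tree-walk u k m = outlier l l≤k p

  module OutRegularTree (d : ℕ) (regular : OutRegular G d) where
    length-tree : ∀ u j → length (tree u j) ≡ M d j
    length-forest : ∀ xs j → length (forest xs j) ≡ length xs * M d j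
    length-tree u zero = refl
    length-tree u (suc j) = begin
      suc (length (forest (outNbrs G u) j)) ≡⟨ cong suc (length-forest (outNbrs G u) j) ⟩
      suc (outdeg G u * M d j)             ≡⟨ cong (λ e → suc (e * M d j)) (regular u) ⟩
      suc (d * M d j)                      ≡⟨ M-suc d j ⟩
      M d (suc j)                          ∎
      where open ≡-Reasoning
    length-forest [] j = refl
    length-forest (x ∷ xs) j =
      trans (length-++ (tree x j)) (cong₂ _+_ (length-tree x j) (length-forest xs j))

  module Geodetic (k : ℕ) (geodetic : KGeodetic G k) where

    no-short-closed-walk : ∀ {v l} → suc l ≤ k → ¬ Walk G v v (suc l)
    no-short-closed-walk le p with () ← geodetic _ _ le z≤n p []

    same-first-step : ∀ {u y y′ z l l′} → suc l ≤ k → suc l′ ≤ k →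
      Arc G u y → Walk G y z l → Arc G u y′ → Walk G y′ z l′ → y ≡ y′
    same-first-step {u} {z = z} le le′ e p e′ p′ =
      cong second (geodetic _ _ le le′ (e ∷ p) (e′ ∷ p′))
      where
        second : Σ ℕ (Walk G u z) → Fin n
        second (_ , []) = u
        second (_ , _∷_ {w = w} _ _) = w

    -- The out-tree of depth j ≤ k has no repeated vertex: distinct entries
    -- correspond to distinct walks of length ≤ k from u.
    tree-unique : ∀ u j → j ≤ k → Unique (tree u j)
    forest-unique : ∀ {u} xs j → (∀ {x} → x ∈ xs → Arc G u x) → Unique xs →
      suc j ≤ k → Unique (forest xs j)
    tree-unique u zero _ = All.[] ∷ []
    tree-unique u (suc j) le =
      All.tabulate root-not-below
        ∷ forest-unique (outNbrs G u) j ∈outNbrs⇒Arc (outNbrs-unique u) le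
      where
        root-not-below : ∀ {z} → z ∈ forest (outNbrs G u) j → ¬ (u ≡ z)
        root-not-below m refl with x , x∈ , l , l≤j , p ← forest-walk (outNbrs G u) j m =
          no-short-closed-walk (≤-trans (s≤s l≤j) le) (∈outNbrs⇒Arc x∈ ∷ p)
    forest-unique [] j _ _ _ = []
    forest-unique (x ∷ xs) j arcs (x∉xs ∷ xs-unique) le =
      Unique.++⁺ (tree-unique x j (≤-trans (n≤1+n j) le))
        (forest-unique xs j (λ m → arcs (there m)) xs-unique le) disjoint
      where
        disjoint : ∀ {z} → ¬ (z ∈ tree x j × z ∈ forest xs j)
        disjoint (m₁ , m₂)
          with l , l≤j , p ← tree-walk x j m₁
             | x′ , x′∈ , l′ , l′≤j , p′ ← forest-walk xs j m₂ =
          All.lookup x∉xs x′∈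
            (same-first-step (≤-trans (s≤s l≤j) le) (≤-trans (s≤s l′≤j) le)
              (arcs (here refl)) p (arcs (there x′∈)) p′)

    open DecMembership (_≟ᶠ_ {n}) using (_∈?_)

    nearInNbrs farInNbrs : Fin n → Fin n → List (Fin n)
    nearInNbrs u v = filter (_∈? tree u k) (inNbrs G v)
    farInNbrs u v = filter (∁? (_∈? tree u k)) (inNbrs G v)

    -- At most outdeg u in-neighbours of v lie in the out-tree of u: the first
    -- arc u → y of the walk u ⇝ x → v determines x, since the rest of that
    -- walk is the unique walk y ⇝ v of length ≤ k.
    near-in-neighbours : ∀ u v → length (nearInNbrs u v) ≤ outdeg G u
    near-in-neighbours u v =
      length-≤-by-injection Reaches (nearInNbrs u v) (outNbrs G u)
        (Unique.filter⁺ _ (inNbrs-unique v)) determined first-arc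
      where
        -- y ⇝ v is a walk of length ≤ k whose last arc leaves x
        Reaches : Fin n → Fin n → Set
        Reaches x y = ∃ λ l → l ≤ k × Σ (Walk G y v l) λ r → penultimate u r ≡ x

        first-arc : ∀ {x} → x ∈ nearInNbrs u v →
          ∃ λ y → y ∈ outNbrs G u × Reaches x y
        first-arc {x} m with x∈I , x∈T ← ∈-filter⁻ (_∈? tree u k) {xs = inNbrs G v} m
                        with l , l≤k , p ← tree-walk u k x∈T
                        with snoc p (∈inNbrs⇒Arc x∈I) | penultimate-snoc u p (∈inNbrs⇒Arc x∈I)
        ... | e ∷ r | r-ends-at-x = _ , Arc⇒∈outNbrs e , l , l≤k , r , r-ends-at-x

        determined : ∀ {x x′ y} → x ∈ nearInNbrs u v → x′ ∈ nearInNbrs u v →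
          Reaches x y → Reaches x′ y → x ≡ x′
        determined _ _ (l , l≤k , r , refl) (l′ , l′≤k , r′ , refl) =
          cong (λ walk → penultimate u (proj₂ walk)) (geodetic _ v l≤k l′≤k r r′)

    far-in-neighbours : ∀ d → OutRegular G d → ∀ u v →
      indeg G v ≤ d + length (farInNbrs u v)
    far-in-neighbours d regular u v = begin
      indeg G v                                        ≡⟨ sym (length-filter-split _ (inNbrs G v)) ⟩
      length (nearInNbrs u v) + length (farInNbrs u v)  ≤⟨ +-monoˡ-≤ _ near≤d ⟩
      d + length (farInNbrs u v)                       ∎
      where
        open ≤-Reasoning
        near≤d : length (nearInNbrs u v) ≤ d
        near≤d = subst (length (nearInNbrs u v) ≤_) (regular u) (near-in-neighbours u v)

    outside-tree-bound : ∀ d → OutRegular G d → ∀ u (ys : List (Fin n)) → Unique ys →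
      (∀ {y} → y ∈ ys → y ∉ tree u k) → length ys + M d k ≤ n
    outside-tree-bound d regular u ys ys-unique outside =
      subst (_≤ n) (trans (length-++ ys) (cong (length ys +_) (length-tree u k)))
        (unique-length-≤ (ys ++ tree u k)
          (Unique.++⁺ ys-unique (tree-unique u k ≤-refl) (λ (m₁ , m₂) → outside m₁ m₂)))
      where open OutRegularTree d regular

-- An outlier w of u that is not an in-neighbour of v′ would be an (ε+1)-st
-- vertex outside T(u), beside the ≥ ε in-neighbours of v′ outside T(u).
lemma6 : (d k ε : ℕ) (G : Digraph (M d k + ε)) →
    KGeodetic G k → OutRegular G d → ¬ Diregular G →
    (v′ : Fin (M d k + ε)) → indeg G v′ ≡ d + ε →
    ∀ (u w : Fin (M d k + ε)) → Outlier G k u w → InNbr G v′ w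
lemma6 d k ε G geodetic regular _ v′ indeg≡d+ε u w outlier with G w v′ in w→v′
... | true = refl
... | false = ⊥-elim (<-irrefl refl too-many-outside)
  where
    open Geodetic G k geodetic

    far : List (Fin (M d k + ε))
    far = farInNbrs u v′

    ε≤far : ε ≤ length far
    ε≤far = +-cancelˡ-≤ d ε (length far)
      (subst (_≤ d + length far) indeg≡d+ε (far-in-neighbours d regular u v′))

    w∉far : w ∉ far
    w∉far m with () ← trans (sym (∈inNbrs⇒Arc G (proj₁ (∈-filter⁻ _ {xs = inNbrs G v′} m)))) w→v′

    w∷far-unique : Unique (w ∷ far)
    w∷far-unique = All.tabulate (λ { m refl → w∉far m }) ∷ Unique.filter⁺ _ (inNbrs-unique G v′)

    w∷far-outside : ∀ {y} → y ∈ w ∷ far → y ∉ tree G u k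
    w∷far-outside (here refl) = outlier-∉-tree G outlier
    w∷far-outside (there m) = proj₂ (∈-filter⁻ _ {xs = inNbrs G v′} m)

    too-many-outside : M d k + ε < M d k + ε
    too-many-outside = begin-strict
      M d k + ε            ≡⟨ +-comm (M d k) ε ⟩
      ε + M d k            ≤⟨ +-monoˡ-≤ (M d k) ε≤far ⟩
      length far + M d k   <⟨ outside-tree-bound d regular u (w ∷ far) w∷far-unique w∷far-outside ⟩
      M d k + ε            ∎
      where open ≤-Reasoning
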